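{- Let $K$ be a field of characteristic different from $2$ and $3$, and let $E:y^2=x^3+ax^2+bx+c$ be an elliptic curve over $K$. Let $f(x)=\prod_i(x-x_i)$ be the monic polynomial whose roots $x_i$ are the $x$-coordinates of the nonzero $3$-torsion points of $E$ (over $\overline{K}$). Then the Lattès map $\phi_{E,2}$ associated to multiplication by $2$ on $E$ is $$\phi_{E,2}(x)=x-3\,\frac{f(x)}{f'(x)}.$$
   Context: The Lattès map $\phi_{E,m}$ associated to $[m]$ is the rational function on $\mathbb{P}^1$ satisfying $\phi_{E,m}(x(P))=x([m]P)$ for all $P\in E(\overline{K})$, where $x(P)$ denotes the $x$-coordinate of $P$. -}

module Defs where

open import Level using (Level; _⊔_)
open import Data.List using (List; []; _∷_; [_]; foldr; map; _++_)
open import Level using (Lift)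
import Data.Unit as Unit
import Data.Empty as Empty
open import Data.Product using (∃; Σ; _×_; _,_)
open import Relation.Nullary using (¬_)
open import Algebra.Bundles using (CommutativeRing)
open import Algebra.Morphism.Structures using (module RingMorphisms)

module Over {c ℓ : Level} (R : CommutativeRing c ℓ) where
  open CommutativeRing R renaming (Carrier to F)

  two three : F
  two = 1# + 1#
  three = 1# + 1# + 1#

  IsField : Set (c ⊔ ℓ)
  IsField = (¬ (1# ≈ 0#)) × (∀ x → ¬ (x ≈ 0#) → ∃ λ y → x * y ≈ 1#)

  CharNot2or3 : Set ℓ
  CharNot2or3 = (¬ (two ≈ 0#)) × (¬ (three ≈ 0#))

  -- Polynomials as coefficient lists, constant term first.
  Poly : Set c
  Poly = List F

  infixl 6 _+p_
  infixl 7 _*p_ _·p_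

  _+p_ : Poly → Poly → Poly
  [] +p q = q
  (a ∷ p) +p [] = a ∷ p
  (a ∷ p) +p (b ∷ q) = (a + b) ∷ (p +p q)

  _·p_ : F → Poly → Poly
  k ·p p = map (k *_) p

  _*p_ : Poly → Poly → Poly
  [] *p q = []
  (a ∷ p) *p q = (a ·p q) +p (0# ∷ (p *p q))

  derivFrom : F → Poly → Poly
  derivFrom k [] = []
  derivFrom k (a ∷ p) = (k * a) ∷ derivFrom (k + 1#) p

  deriv : Poly → Poly
  deriv [] = []
  deriv (a ∷ p) = derivFrom 1# p

  eval : Poly → F → F
  eval [] x = 0#
  eval (a ∷ p) x = a + x * eval p x

  prodLinear : List F → Poly
  prodLinear = foldr (λ r acc → ((- r) ∷ 1# ∷ []) *p acc) [ 1# ]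

  AlgClosed : Set (c ⊔ ℓ)
  AlgClosed = ∀ (c₀ : F) (cs : List F) → ∃ λ x → eval (c₀ ∷ (cs ++ [ 1# ])) x ≈ 0#

  discriminant : F → F → F → F
  discriminant a b c' =
    (a * a * b * b) - (four * b * b * b) - (four * a * a * a * c')
      - (twentySeven * c' * c') + (eighteen * a * b * c')
    where
    four = two * two
    twentySeven = three * three * three
    eighteen = two * three * three

  -- projective points: the point at infinity O, or an affine point (x , y)
  data Pt : Set c where
    O   : Pt
    aff : F → F → Pt

  PtEq : Pt → Pt → Set ℓ
  PtEq O O = Lift ℓ Unit.⊤
  PtEq O (aff _ _) = Lift ℓ Empty.⊥
  PtEq (aff _ _) O = Lift ℓ Empty.⊥
  PtEq (aff x y) (aff x' y') = (x ≈ x') × (y ≈ y')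

  module Curve (A B C : F) where

    OnCurve : Pt → Set ℓ
    OnCurve O = Lift ℓ Unit.⊤
    OnCurve (aff x y) = y * y ≈ x * x * x + A * x * x + B * x + C

    data Add : Pt → Pt → Pt → Set (c ⊔ ℓ) where
      O-left  : ∀ {Q R} → PtEq R Q → Add O Q R
      O-right : ∀ {P R} → PtEq R P → Add P O R
      chord   : ∀ {x₁ y₁ x₂ y₂ x₃ y₃} (λ' : F) → ¬ (x₁ ≈ x₂) →
                λ' * (x₂ - x₁) ≈ y₂ - y₁ →
                x₃ ≈ λ' * λ' - A - x₁ - x₂ →
                y₃ ≈ λ' * (x₁ - x₃) - y₁ →
                Add (aff x₁ y₁) (aff x₂ y₂) (aff x₃ y₃)
      vertical : ∀ {x₁ y₁ x₂ y₂} → x₁ ≈ x₂ → y₁ + y₂ ≈ 0# →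
                Add (aff x₁ y₁) (aff x₂ y₂) O
      tangent : ∀ {x₁ y₁ x₂ y₂ x₃ y₃} (λ' : F) → x₁ ≈ x₂ → y₁ ≈ y₂ → ¬ (y₁ ≈ 0#) →
                λ' * (two * y₁) ≈ three * x₁ * x₁ + two * A * x₁ + B →
                x₃ ≈ λ' * λ' - A - two * x₁ →
                y₃ ≈ λ' * (x₁ - x₃) - y₁ →
                Add (aff x₁ y₁) (aff x₂ y₂) (aff x₃ y₃)

    ThreeTorsion : Pt → Set (c ⊔ ℓ)
    ThreeTorsion P = ∃ λ Q → Add P P Q × Add Q P O

{-# OPTIONS --safe #-}
-- Write h for the cubic and ψ for the 3-division polynomial 3x⁴ + 4ax³ + 6bx² + 12cx + (4ac - b²)
-- divided by 3. Then 3ψ = 4h·(3x + a) - h′² and ψ′ = 4h, so on the tangent at P = (x , y), of slope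
-- λ = h′(x)/2y, one has 3ψ(x) = 4y²·(3x + a - λ²); the doubling formula x([2]P) = λ² - a - 2x thus
-- becomes x([2]P)·ψ′(x) = x·ψ′(x) - 3ψ(x). The same identity shows that [2]P = -P, i.e. [3]P = O,
-- exactly when ψ(x) = 0. As the discriminant is a combination of h and h′, no root of ψ is a root of
-- h = ψ′/4, so ψ is separable and, over the algebraically closed field, splits as ∏ (X - xᵢ) over the
-- distinct 3-torsion abscissae: ψ = f.
module Submission where

open import Defs
open import Data.List using (List)
open import Data.Product using (∃; _×_)
open import Relation.Nullary using (¬_)
open import Algebra.Bundles using (CommutativeRing)
open import Algebra.Morphism.Structures using (module RingMorphisms)
open import Data.List.Relation.Unary.Unique.Setoid using (Unique)
open import Data.List.Membership.Setoid using (_∈_)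

open import Algebra.Solver.Ring.AlmostCommutativeRing using (fromCommutativeRing; _-Raw-AlmostCommutative⟶_)
open import Data.Empty using (⊥-elim)
open import Data.Integer as ℤ using (ℤ; +_; -[1+_]; _⊖_)
import Data.Integer.Properties as ℤ
open import Data.List using ([]; _∷_; [_]; _++_; length)
import Data.List.Membership.Setoid as Membership
open import Data.List.Membership.Setoid.Properties using (∈-resp-≈; ∈-∃++; All[≉]⇒∉)
import Data.List.Relation.Binary.Equality.Setoid as ListEquality
import Data.List.Relation.Binary.Permutation.Setoid as Permutation
import Data.List.Relation.Binary.Permutation.Setoid.Properties as PermutationProperties
open import Data.List.Relation.Binary.Pointwise using ([]; _∷_)
import Data.List.Relation.Binary.Subset.Setoid as Subset
import Data.List.Relation.Unary.All as All
open import Data.List.Relation.Unary.AllPairs as AllPairs using ([]; _∷_)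
open import Data.List.Relation.Unary.Any using (here; there)
open import Data.Maybe using (Maybe; just; nothing)
open import Data.Nat as ℕ using (ℕ; zero; suc)
import Data.Nat.Properties as ℕ
open import Data.Product using (_,_; proj₁; proj₂)
open import Data.Sign as Sign using (Sign)
open import Function using (id)
open import Level using (_⊔_)
open import Relation.Binary.Bundles using (Setoid)
open import Relation.Binary.PropositionalEquality as ≡ using (_≡_)
open import Relation.Nullary using (yes; no)

module SetoidLists {c ℓ} (S : Setoid c ℓ) where
  open Setoid S
  open Membership S using () renaming (_∈_ to _∈ₛ_)
  open Permutation S using (_↭_; ↭-trans; ↭-reflexive-≋)
  open PermutationProperties S using (shift)

  head-distinct : ∀ {r t xs} → Unique S (r ∷ xs) → t ∈ₛ xs → ¬ t ≈ r
  head-distinct (r∉xs ∷ _) t∈xs t≈r = All[≉]⇒∉ S r∉xs (∈-resp-≈ S t≈r t∈xs)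

  ∈⇒↭∷ : ∀ {r xs} → r ∈ₛ xs → ∃ λ xs′ → xs ↭ r ∷ xs′
  ∈⇒↭∷ r∈xs with ∈-∃++ S r∈xs
  ... | ys , zs , w , r≈w , xs≋ys++w∷zs =
    ys ++ zs , ↭-trans (↭-reflexive-≋ xs≋ys++w∷zs) (shift (sym r≈w) ys zs)

module IntegerCoefficients {c ℓ} (R : CommutativeRing c ℓ) where
  open CommutativeRing R
  open import Relation.Binary.Reasoning.Setoid setoid
  open import Algebra.Properties.Ring ring
    using (-‿involutive; -‿distribˡ-*; -‿distribʳ-*; -0#≈0#; -‿+-comm)
  open import Algebra.Properties.Semiring.Mult.TCOptimised semiring
    using (1+×; ×-homo-+; ×1-homo-*) renaming (_×_ to _×′_)

  -- With this multiplication fromℕ 1, fromℕ 2 and fromℕ 3 are definitionally 1#, two and three,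
  -- so solver constants κ 1, κ 2, κ 3 match them.
  fromℕ : ℕ → Carrier
  fromℕ n = n ×′ 1#

  signed : Sign → Carrier → Carrier
  signed Sign.+ x = x
  signed Sign.- x = - x

  ⟦_⟧ℤ : ℤ → Carrier
  ⟦ i ⟧ℤ = signed (ℤ.sign i) (fromℕ ℤ.∣ i ∣)

  ⟦◃⟧ : ∀ s n → ⟦ s ℤ.◃ n ⟧ℤ ≈ signed s (fromℕ n)
  ⟦◃⟧ Sign.+ zero = refl
  ⟦◃⟧ Sign.- zero = sym -0#≈0#
  ⟦◃⟧ Sign.+ (suc n) = refl
  ⟦◃⟧ Sign.- (suc n) = refl

  signed-cong : ∀ s {x y} → x ≈ y → signed s x ≈ signed s y
  signed-cong Sign.+ = id
  signed-cong Sign.- = -‿cong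

  signed-* : ∀ s t x y → signed (s Sign.* t) (x * y) ≈ signed s x * signed t y
  signed-* Sign.+ Sign.+ x y = refl
  signed-* Sign.+ Sign.- x y = -‿distribʳ-* x y
  signed-* Sign.- Sign.+ x y = -‿distribˡ-* x y
  signed-* Sign.- Sign.- x y = begin
    x * y             ≈⟨ -‿involutive (x * y) ⟨
    - - (x * y)       ≈⟨ -‿cong (-‿distribʳ-* x y) ⟩
    - (x * - y)       ≈⟨ -‿distribˡ-* x (- y) ⟩
    - x * - y         ∎

  ⟦⊖⟧ : ∀ m n → ⟦ m ⊖ n ⟧ℤ ≈ fromℕ m - fromℕ n
  ⟦⊖⟧ m zero = sym (trans (+-congˡ -0#≈0#) (+-identityʳ _))
  ⟦⊖⟧ zero (suc n) = sym (+-identityˡ _)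
  ⟦⊖⟧ (suc m) (suc n) = begin
    ⟦ suc m ⊖ suc n ⟧ℤ          ≡⟨ ≡.cong ⟦_⟧ℤ (ℤ.[1+m]⊖[1+n]≡m⊖n m n) ⟩
    ⟦ m ⊖ n ⟧ℤ                  ≈⟨ ⟦⊖⟧ m n ⟩
    fromℕ m - fromℕ n              ≈⟨ cancel 1# (fromℕ m) (fromℕ n) ⟨
    1# + fromℕ m - (1# + fromℕ n)  ≈⟨ +-cong (1+× m 1#) (-‿cong (1+× n 1#)) ⟨
    fromℕ (suc m) - fromℕ (suc n)  ∎
    where
    cancel : ∀ a x y → a + x - (a + y) ≈ x - y
    cancel a x y = begin
      a + x - (a + y)      ≈⟨ +-congˡ (sym (-‿+-comm a y)) ⟩
      a + x + (- a + - y)  ≈⟨ +-assoc a x _ ⟩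
      a + (x + (- a + - y)) ≈⟨ +-congˡ (sym (+-assoc x _ _)) ⟩
      a + (x - a - y)      ≈⟨ +-congˡ (+-congʳ (+-comm x (- a))) ⟩
      a + (- a + x - y)    ≈⟨ +-congˡ (+-assoc (- a) x _) ⟩
      a + (- a + (x - y))  ≈⟨ +-assoc a (- a) _ ⟨
      a - a + (x - y)      ≈⟨ +-congʳ (-‿inverseʳ a) ⟩
      0# + (x - y)         ≈⟨ +-identityˡ _ ⟩
      x - y                ∎

  ⟦+⟧ : ∀ i j → ⟦ i ℤ.+ j ⟧ℤ ≈ ⟦ i ⟧ℤ + ⟦ j ⟧ℤ
  ⟦+⟧ (+ m) (+ n) = ×-homo-+ 1# m n
  ⟦+⟧ (+ m) -[1+ n ] = ⟦⊖⟧ m (suc n)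
  ⟦+⟧ -[1+ m ] (+ n) = trans (⟦⊖⟧ n (suc m)) (+-comm _ _)
  ⟦+⟧ -[1+ m ] -[1+ n ] = begin
    - fromℕ (suc (suc (m ℕ.+ n)))          ≡⟨ ≡.cong (λ k → - fromℕ (suc k)) (ℕ.+-suc m n) ⟨
    - fromℕ (suc m ℕ.+ suc n)              ≈⟨ -‿cong (×-homo-+ 1# (suc m) (suc n)) ⟩
    - (fromℕ (suc m) + fromℕ (suc n))         ≈⟨ -‿+-comm _ _ ⟨
    - fromℕ (suc m) + - fromℕ (suc n)         ∎

  ⟦*⟧ : ∀ i j → ⟦ i ℤ.* j ⟧ℤ ≈ ⟦ i ⟧ℤ * ⟦ j ⟧ℤ
  ⟦*⟧ i j = begin
    ⟦ s ℤ.◃ ∣i∣ ℕ.* ∣j∣ ⟧ℤ      ≈⟨ ⟦◃⟧ s (∣i∣ ℕ.* ∣j∣) ⟩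
    signed s (fromℕ (∣i∣ ℕ.* ∣j∣))   ≈⟨ signed-cong s (×1-homo-* ∣i∣ ∣j∣) ⟩
    signed s (fromℕ ∣i∣ * fromℕ ∣j∣) ≈⟨ signed-* (ℤ.sign i) (ℤ.sign j) _ _ ⟩
    ⟦ i ⟧ℤ * ⟦ j ⟧ℤ              ∎
    where
    s : Sign
    s = ℤ.sign i Sign.* ℤ.sign j
    ∣i∣ ∣j∣ : ℕ
    ∣i∣ = ℤ.∣ i ∣
    ∣j∣ = ℤ.∣ j ∣

  ⟦-⟧ : ∀ i → ⟦ ℤ.- i ⟧ℤ ≈ - ⟦ i ⟧ℤ
  ⟦-⟧ (+ zero) = sym -0#≈0#
  ⟦-⟧ (+ suc n) = refl
  ⟦-⟧ -[1+ n ] = sym (-‿involutive _)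

  ℤ-homomorphism : ℤ.+-*-rawRing -Raw-AlmostCommutative⟶ fromCommutativeRing R
  ℤ-homomorphism = record
    { ⟦_⟧ = ⟦_⟧ℤ ; +-homo = ⟦+⟧ ; *-homo = ⟦*⟧ ; -‿homo = ⟦-⟧
    ; 0-homo = refl ; 1-homo = refl
    }

  ℤ-equal? : ∀ i j → Maybe (⟦ i ⟧ℤ ≈ ⟦ j ⟧ℤ)
  ℤ-equal? i j with i ℤ.≟ j
  ... | yes i≡j = just (reflexive (≡.cong ⟦_⟧ℤ i≡j))
  ... | no _ = nothing

  open import Algebra.Solver.Ring ℤ.+-*-rawRing (fromCommutativeRing R) ℤ-homomorphism ℤ-equal? public

  κ : ∀ {n} → ℕ → Polynomial n
  κ k = con (+ k)

module Polynomials {c ℓ} (R : CommutativeRing c ℓ) where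
  open CommutativeRing R
  open Over R
  open IntegerCoefficients R
  open import Relation.Binary.Reasoning.Setoid setoid
  open import Algebra.Properties.CommutativeSemigroup *-commutativeSemigroup using (x∙yz≈y∙xz)
  open ListEquality setoid using (_≋_)
  open Membership setoid using () renaming (_∈_ to _∈ₛ_)
  private module ↭ = Permutation setoid
  open ↭ using (_↭_)

  eval′ : Poly → Carrier → Carrier
  eval′ p = eval (deriv p)

  eval-derivFrom : ∀ k p X → eval (derivFrom k p) X ≈ k * eval p X + X * eval′ p X
  eval-derivFrom k [] X = solve 2 (λ k X → κ 0 := k :* κ 0 :+ X :* κ 0) refl k X
  eval-derivFrom k (a ∷ p) X = begin
    k * a + X * eval (derivFrom (k + 1#) p) X
      ≈⟨ +-congˡ (*-congˡ (eval-derivFrom (k + 1#) p X)) ⟩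
    k * a + X * ((k + 1#) * eval p X + X * eval′ p X)
      ≈⟨ solve 5 (λ k a X e e′ → k :* a :+ X :* ((k :+ κ 1) :* e :+ X :* e′)
                              := k :* (a :+ X :* e) :+ X :* (κ 1 :* e :+ X :* e′))
                 refl k a X (eval p X) (eval′ p X) ⟩
    k * (a + X * eval p X) + X * (1# * eval p X + X * eval′ p X)
      ≈⟨ +-congˡ (*-congˡ (eval-derivFrom 1# p X)) ⟨
    k * (a + X * eval p X) + X * eval′ (a ∷ p) X ∎

  eval′-∷ : ∀ a p X → eval′ (a ∷ p) X ≈ eval p X + X * eval′ p X
  eval′-∷ a p X = trans (eval-derivFrom 1# p X) (+-congʳ (*-identityˡ _))

  eval-+p : ∀ p q X → eval (p +p q) X ≈ eval p X + eval q X
  eval-+p [] q X = sym (+-identityˡ _)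
  eval-+p (a ∷ p) [] X = sym (+-identityʳ _)
  eval-+p (a ∷ p) (b ∷ q) X = begin
    a + b + X * eval (p +p q) X          ≈⟨ +-congˡ (*-congˡ (eval-+p p q X)) ⟩
    a + b + X * (eval p X + eval q X)
      ≈⟨ solve 5 (λ a b X e f → a :+ b :+ X :* (e :+ f) := (a :+ X :* e) :+ (b :+ X :* f))
                 refl a b X (eval p X) (eval q X) ⟩
    (a + X * eval p X) + (b + X * eval q X) ∎

  eval′-+p : ∀ p q X → eval′ (p +p q) X ≈ eval′ p X + eval′ q X
  eval′-+p [] q X = sym (+-identityˡ _)
  eval′-+p (a ∷ p) [] X = sym (+-identityʳ _)
  eval′-+p (a ∷ p) (b ∷ q) X = begin
    eval′ ((a + b) ∷ (p +p q)) X             ≈⟨ eval′-∷ (a + b) (p +p q) X ⟩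
    eval (p +p q) X + X * eval′ (p +p q) X   ≈⟨ +-cong (eval-+p p q X) (*-congˡ (eval′-+p p q X)) ⟩
    (eval p X + eval q X) + X * (eval′ p X + eval′ q X)
      ≈⟨ solve 5 (λ X e f e′ f′ → (e :+ f) :+ X :* (e′ :+ f′) := (e :+ X :* e′) :+ (f :+ X :* f′))
                 refl X (eval p X) (eval q X) (eval′ p X) (eval′ q X) ⟩
    (eval p X + X * eval′ p X) + (eval q X + X * eval′ q X)
      ≈⟨ +-cong (eval′-∷ a p X) (eval′-∷ b q X) ⟨
    eval′ (a ∷ p) X + eval′ (b ∷ q) X ∎

  eval-·p : ∀ k p X → eval (k ·p p) X ≈ k * eval p X
  eval-·p k [] X = sym (zeroʳ _)
  eval-·p k (a ∷ p) X = begin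
    k * a + X * eval (k ·p p) X    ≈⟨ +-congˡ (*-congˡ (eval-·p k p X)) ⟩
    k * a + X * (k * eval p X)
      ≈⟨ solve 4 (λ k a X e → k :* a :+ X :* (k :* e) := k :* (a :+ X :* e)) refl k a X (eval p X) ⟩
    k * (a + X * eval p X)         ∎

  eval′-·p : ∀ k p X → eval′ (k ·p p) X ≈ k * eval′ p X
  eval′-·p k [] X = sym (zeroʳ _)
  eval′-·p k (a ∷ p) X = begin
    eval′ ((k * a) ∷ (k ·p p)) X               ≈⟨ eval′-∷ (k * a) (k ·p p) X ⟩
    eval (k ·p p) X + X * eval′ (k ·p p) X     ≈⟨ +-cong (eval-·p k p X) (*-congˡ (eval′-·p k p X)) ⟩
    k * eval p X + X * (k * eval′ p X)
      ≈⟨ solve 4 (λ k X e e′ → k :* e :+ X :* (k :* e′) := k :* (e :+ X :* e′))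
                 refl k X (eval p X) (eval′ p X) ⟩
    k * (eval p X + X * eval′ p X)             ≈⟨ *-congˡ (eval′-∷ a p X) ⟨
    k * eval′ (a ∷ p) X                         ∎

  eval-*p : ∀ p q X → eval (p *p q) X ≈ eval p X * eval q X
  eval-*p [] q X = sym (zeroˡ _)
  eval-*p (a ∷ p) q X = begin
    eval ((a ·p q) +p (0# ∷ (p *p q))) X         ≈⟨ eval-+p (a ·p q) (0# ∷ (p *p q)) X ⟩
    eval (a ·p q) X + (0# + X * eval (p *p q) X)
      ≈⟨ +-cong (eval-·p a q X) (+-congˡ (*-congˡ (eval-*p p q X))) ⟩
    a * eval q X + (0# + X * (eval p X * eval q X))
      ≈⟨ solve 4 (λ a X e f → a :* f :+ (κ 0 :+ X :* (e :* f)) := (a :+ X :* e) :* f)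
                 refl a X (eval p X) (eval q X) ⟩
    (a + X * eval p X) * eval q X                  ∎

  eval′-*p : ∀ p q X → eval′ (p *p q) X ≈ eval′ p X * eval q X + eval p X * eval′ q X
  eval′-*p [] q X = solve 2 (λ f f′ → κ 0 := κ 0 :* f :+ κ 0 :* f′) refl (eval q X) (eval′ q X)
  eval′-*p (a ∷ p) q X = begin
    eval′ ((a ·p q) +p (0# ∷ (p *p q))) X         ≈⟨ eval′-+p (a ·p q) (0# ∷ (p *p q)) X ⟩
    eval′ (a ·p q) X + eval′ (0# ∷ (p *p q)) X    ≈⟨ +-cong (eval′-·p a q X) (eval′-∷ 0# (p *p q) X) ⟩
    a * eval′ q X + (eval (p *p q) X + X * eval′ (p *p q) X)
      ≈⟨ +-congˡ (+-cong (eval-*p p q X) (*-congˡ (eval′-*p p q X))) ⟩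
    a * F′ + (E * F + X * (E′ * F + E * F′))
      ≈⟨ solve 6 (λ a X e f e′ f′ → a :* f′ :+ (e :* f :+ X :* (e′ :* f :+ e :* f′))
                                  := (e :+ X :* e′) :* f :+ (a :+ X :* e) :* f′)
                 refl a X E F E′ F′ ⟩
    (E + X * E′) * F + (a + X * E) * F′          ≈⟨ +-congʳ (*-congʳ (eval′-∷ a p X)) ⟨
    eval′ (a ∷ p) X * F + eval (a ∷ p) X * F′     ∎
    where
    E E′ F F′ : Carrier
    E = eval p X
    E′ = eval′ p X
    F = eval q X
    F′ = eval′ q X

  infix 4 _≃_
  record _≃_ (p q : Poly) : Set (c ⊔ ℓ) where
    field
      eval-≈ : ∀ X → eval p X ≈ eval q X
      eval′-≈ : ∀ X → eval′ p X ≈ eval′ q X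
  open _≃_ public

  ≃-refl : ∀ {p} → p ≃ p
  ≃-refl = record { eval-≈ = λ _ → refl ; eval′-≈ = λ _ → refl }

  ≃-sym : ∀ {p q} → p ≃ q → q ≃ p
  ≃-sym p≃q = record
    { eval-≈ = λ X → sym (eval-≈ p≃q X)
    ; eval′-≈ = λ X → sym (eval′-≈ p≃q X)
    }

  ≃-trans : ∀ {p q s} → p ≃ q → q ≃ s → p ≃ s
  ≃-trans p≃q q≃s = record
    { eval-≈ = λ X → trans (eval-≈ p≃q X) (eval-≈ q≃s X)
    ; eval′-≈ = λ X → trans (eval′-≈ p≃q X) (eval′-≈ q≃s X)
    }

  linear : Carrier → Poly
  linear r = (- r) ∷ 1# ∷ []

  eval-linear-*p : ∀ r p X → eval (linear r *p p) X ≈ (X - r) * eval p X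
  eval-linear-*p r p X = trans (eval-*p (linear r) p X)
    (*-congʳ (solve 2 (λ r X → :- r :+ X :* (κ 1 :+ X :* κ 0) := X :- r) refl r X))

  eval′-linear-*p : ∀ r p X → eval′ (linear r *p p) X ≈ eval p X + (X - r) * eval′ p X
  eval′-linear-*p r p X = begin
    eval′ (linear r *p p) X
      ≈⟨ eval′-*p (linear r) p X ⟩
    eval′ (linear r) X * eval p X + eval (linear r) X * eval′ p X
      ≈⟨ solve 4 (λ r X e e′ → (κ 1 :* κ 1 :+ X :* κ 0) :* e :+ (:- r :+ X :* (κ 1 :+ X :* κ 0)) :* e′
                             := e :+ (X :- r) :* e′)
                 refl r X (eval p X) (eval′ p X) ⟩
    eval p X + (X - r) * eval′ p X ∎

  linear-*p-cong : ∀ {r s p q} → r ≈ s → p ≃ q → linear r *p p ≃ linear s *p q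
  linear-*p-cong {r} {s} {p} {q} r≈s p≃q = record { eval-≈ = value ; eval′-≈ = slope }
    where
    X-r≈X-s : ∀ X → X - r ≈ X - s
    X-r≈X-s X = +-congˡ (-‿cong r≈s)
    value : ∀ X → eval (linear r *p p) X ≈ eval (linear s *p q) X
    value X = begin
      eval (linear r *p p) X     ≈⟨ eval-linear-*p r p X ⟩
      (X - r) * eval p X         ≈⟨ *-cong (X-r≈X-s X) (eval-≈ p≃q X) ⟩
      (X - s) * eval q X         ≈⟨ eval-linear-*p s q X ⟨
      eval (linear s *p q) X     ∎
    slope : ∀ X → eval′ (linear r *p p) X ≈ eval′ (linear s *p q) X
    slope X = begin
      eval′ (linear r *p p) X          ≈⟨ eval′-linear-*p r p X ⟩
      eval p X + (X - r) * eval′ p X   ≈⟨ +-cong (eval-≈ p≃q X) (*-cong (X-r≈X-s X) (eval′-≈ p≃q X)) ⟩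
      eval q X + (X - s) * eval′ q X   ≈⟨ eval′-linear-*p s q X ⟨
      eval′ (linear s *p q) X          ∎

  linear-*p-comm : ∀ r s p → linear r *p (linear s *p p) ≃ linear s *p (linear r *p p)
  linear-*p-comm r s p = record { eval-≈ = value ; eval′-≈ = slope }
    where
    value : ∀ X → eval (linear r *p (linear s *p p)) X ≈ eval (linear s *p (linear r *p p)) X
    value X = begin
      eval (linear r *p (linear s *p p)) X   ≈⟨ eval-linear-*p r (linear s *p p) X ⟩
      (X - r) * eval (linear s *p p) X       ≈⟨ *-congˡ (eval-linear-*p s p X) ⟩
      (X - r) * ((X - s) * eval p X)         ≈⟨ x∙yz≈y∙xz (X - r) (X - s) (eval p X) ⟩
      (X - s) * ((X - r) * eval p X)         ≈⟨ *-congˡ (eval-linear-*p r p X) ⟨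
      (X - s) * eval (linear r *p p) X       ≈⟨ eval-linear-*p s (linear r *p p) X ⟨
      eval (linear s *p (linear r *p p)) X   ∎
    slope : ∀ X → eval′ (linear r *p (linear s *p p)) X ≈ eval′ (linear s *p (linear r *p p)) X
    slope X = begin
      eval′ (linear r *p (linear s *p p)) X
        ≈⟨ eval′-linear-*p r (linear s *p p) X ⟩
      eval (linear s *p p) X + (X - r) * eval′ (linear s *p p) X
        ≈⟨ +-cong (eval-linear-*p s p X) (*-congˡ (eval′-linear-*p s p X)) ⟩
      (X - s) * E + (X - r) * (E + (X - s) * E′)
        ≈⟨ solve 5 (λ X r s e e′ → (X :- s) :* e :+ (X :- r) :* (e :+ (X :- s) :* e′)
                                := (X :- r) :* e :+ (X :- s) :* (e :+ (X :- r) :* e′))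
                   refl X r s E E′ ⟩
      (X - r) * E + (X - s) * (E + (X - r) * E′)
        ≈⟨ +-cong (eval-linear-*p r p X) (*-congˡ (eval′-linear-*p r p X)) ⟨
      eval (linear r *p p) X + (X - s) * eval′ (linear r *p p) X
        ≈⟨ eval′-linear-*p s (linear r *p p) X ⟨
      eval′ (linear s *p (linear r *p p)) X ∎
      where
      E E′ : Carrier
      E = eval p X
      E′ = eval′ p X

  prodLinear-resp-≋ : ∀ {xs ys} → xs ≋ ys → prodLinear xs ≃ prodLinear ys
  prodLinear-resp-≋ [] = ≃-refl
  prodLinear-resp-≋ (x≈y ∷ xs≋ys) = linear-*p-cong x≈y (prodLinear-resp-≋ xs≋ys)

  prodLinear-resp-↭ : ∀ {xs ys} → xs ↭ ys → prodLinear xs ≃ prodLinear ys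
  prodLinear-resp-↭ (↭.refl xs≋ys) = prodLinear-resp-≋ xs≋ys
  prodLinear-resp-↭ (↭.prep x≈y xs↭ys) = linear-*p-cong x≈y (prodLinear-resp-↭ xs↭ys)
  prodLinear-resp-↭ (↭.swap {x = x} {y} x≈x′ y≈y′ xs↭ys) =
    ≃-trans (linear-*p-comm x y _) (linear-*p-cong y≈y′ (linear-*p-cong x≈x′ (prodLinear-resp-↭ xs↭ys)))
  prodLinear-resp-↭ (↭.trans xs↭ys ys↭zs) =
    ≃-trans (prodLinear-resp-↭ xs↭ys) (prodLinear-resp-↭ ys↭zs)

  monic : List Carrier → Poly
  monic cs = cs ++ [ 1# ]

  -- Synthetic division by X - r: the coefficients of the quotient are the values at r of the
  -- successive tails of the dividend.
  quotient : Carrier → List Carrier → List Carrier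
  quotient r [] = []
  quotient r (c₀ ∷ []) = []
  quotient r (c₀ ∷ c₁ ∷ cs) = eval (monic (c₁ ∷ cs)) r ∷ quotient r (c₁ ∷ cs)

  length-quotient : ∀ r c₀ cs → length (quotient r (c₀ ∷ cs)) ≡ length cs
  length-quotient r c₀ [] = ≡.refl
  length-quotient r c₀ (c₁ ∷ cs) = ≡.cong suc (length-quotient r c₁ cs)

  eval-division : ∀ r c₀ cs X →
    eval (monic (c₀ ∷ cs)) X ≈ (X - r) * eval (monic (quotient r (c₀ ∷ cs))) X + eval (monic (c₀ ∷ cs)) r
  eval-division r c₀ [] X =
    solve 3 (λ c X r → c :+ X :* (κ 1 :+ X :* κ 0)
                     := (X :- r) :* (κ 1 :+ X :* κ 0) :+ (c :+ r :* (κ 1 :+ r :* κ 0)))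
          refl c₀ X r
  eval-division r c₀ (c₁ ∷ cs) X = begin
    c₀ + X * eval p X                     ≈⟨ +-congˡ (*-congˡ (eval-division r c₁ cs X)) ⟩
    c₀ + X * ((X - r) * eval q X + eval p r)
      ≈⟨ solve 5 (λ c X r e f → c :+ X :* ((X :- r) :* f :+ e) := (X :- r) :* (e :+ X :* f) :+ (c :+ r :* e))
                 refl c₀ X r (eval p r) (eval q X) ⟩
    (X - r) * (eval p r + X * eval q X) + (c₀ + r * eval p r) ∎
    where
    p q : Poly
    p = monic (c₁ ∷ cs)
    q = monic (quotient r (c₁ ∷ cs))

  eval′-division : ∀ r c₀ cs X →
    eval′ (monic (c₀ ∷ cs)) X
      ≈ eval (monic (quotient r (c₀ ∷ cs))) X + (X - r) * eval′ (monic (quotient r (c₀ ∷ cs))) X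
  eval′-division r c₀ [] X =
    solve 2 (λ X r → κ 1 :* κ 1 :+ X :* κ 0 := (κ 1 :+ X :* κ 0) :+ (X :- r) :* κ 0) refl X r
  eval′-division r c₀ (c₁ ∷ cs) X = begin
    eval′ (c₀ ∷ p) X                       ≈⟨ eval′-∷ c₀ p X ⟩
    eval p X + X * eval′ p X
      ≈⟨ +-cong (eval-division r c₁ cs X) (*-congˡ (eval′-division r c₁ cs X)) ⟩
    ((X - r) * eval q X + eval p r) + X * (eval q X + (X - r) * eval′ q X)
      ≈⟨ solve 5 (λ X r e f f′ → ((X :- r) :* f :+ e) :+ X :* (f :+ (X :- r) :* f′)
                              := (e :+ X :* f) :+ (X :- r) :* (f :+ X :* f′))
                 refl X r (eval p r) (eval q X) (eval′ q X) ⟩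
    (eval p r + X * eval q X) + (X - r) * (eval q X + X * eval′ q X)
      ≈⟨ +-congˡ (*-congˡ (eval′-∷ (eval p r) q X)) ⟨
    eval (eval p r ∷ q) X + (X - r) * eval′ (eval p r ∷ q) X ∎
    where
    p q : Poly
    p = monic (c₁ ∷ cs)
    q = monic (quotient r (c₁ ∷ cs))

  factor-theorem : ∀ r c₀ cs → eval (monic (c₀ ∷ cs)) r ≈ 0# →
                   monic (c₀ ∷ cs) ≃ linear r *p monic (quotient r (c₀ ∷ cs))
  factor-theorem r c₀ cs root = record
    { eval-≈ = λ X → begin
        eval (monic (c₀ ∷ cs)) X               ≈⟨ eval-division r c₀ cs X ⟩
        (X - r) * eval q X + eval (monic (c₀ ∷ cs)) r ≈⟨ +-congˡ root ⟩
        (X - r) * eval q X + 0#                ≈⟨ +-identityʳ _ ⟩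
        (X - r) * eval q X                     ≈⟨ eval-linear-*p r q X ⟨
        eval (linear r *p q) X                 ∎
    ; eval′-≈ = λ X → trans (eval′-division r c₀ cs X) (sym (eval′-linear-*p r q X))
    }
    where q = monic (quotient r (c₀ ∷ cs))

  monic-splits : AlgClosed → ∀ cs → ∃ λ rs → monic cs ≃ prodLinear rs
  monic-splits closed cs = splits (length cs) cs ≡.refl
    where
    splits : ∀ n cs → length cs ≡ n → ∃ λ rs → monic cs ≃ prodLinear rs
    splits zero [] _ = [] , ≃-refl
    splits (suc n) (c₀ ∷ cs) |cs|≡n with closed c₀ cs
    ... | r , root
      with splits n (quotient r (c₀ ∷ cs)) (≡.trans (length-quotient r c₀ cs) (ℕ.suc-injective |cs|≡n))
    ... | rs , q≃ = r ∷ rs , ≃-trans (factor-theorem r c₀ cs root) (linear-*p-cong refl q≃)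

  prodLinear-root : ∀ {t rs} → t ∈ₛ rs → eval (prodLinear rs) t ≈ 0#
  prodLinear-root {t} {r ∷ rs} (here t≈r) = begin
    eval (prodLinear (r ∷ rs)) t    ≈⟨ eval-linear-*p r (prodLinear rs) t ⟩
    (t - r) * eval (prodLinear rs) t ≈⟨ *-congʳ (trans (+-congʳ t≈r) (-‿inverseʳ r)) ⟩
    0# * eval (prodLinear rs) t      ≈⟨ zeroˡ _ ⟩
    0#                               ∎
  prodLinear-root {t} {r ∷ rs} (there t∈rs) = begin
    eval (prodLinear (r ∷ rs)) t    ≈⟨ eval-linear-*p r (prodLinear rs) t ⟩
    (t - r) * eval (prodLinear rs) t ≈⟨ *-congˡ (prodLinear-root t∈rs) ⟩
    (t - r) * 0#                     ≈⟨ zeroʳ _ ⟩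
    0#                               ∎

  simple-roots⇒Unique : ∀ rs → (∀ {s} → s ∈ₛ rs → ¬ eval′ (prodLinear rs) s ≈ 0#) →
                        Unique setoid rs
  simple-roots⇒Unique [] simple = []
  simple-roots⇒Unique (r ∷ rs) simple =
    All.tabulateₛ setoid (λ s∈rs r≈s →
      simple (here refl) (double-root (∈-resp-≈ setoid (sym r≈s) s∈rs)))
    ∷ simple-roots⇒Unique rs (λ s∈rs slope≈0 → simple (there s∈rs) (root-of-derivative s∈rs slope≈0))
    where
    slope : ∀ s → eval′ (prodLinear (r ∷ rs)) s
                  ≈ eval (prodLinear rs) s + (s - r) * eval′ (prodLinear rs) s
    slope = eval′-linear-*p r (prodLinear rs)
    double-root : r ∈ₛ rs → eval′ (prodLinear (r ∷ rs)) r ≈ 0#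
    double-root r∈rs = begin
      eval′ (prodLinear (r ∷ rs)) r ≈⟨ slope r ⟩
      eval (prodLinear rs) r + (r - r) * eval′ (prodLinear rs) r
        ≈⟨ +-cong (prodLinear-root r∈rs) (trans (*-congʳ (-‿inverseʳ r)) (zeroˡ _)) ⟩
      0# + 0#                       ≈⟨ +-identityʳ 0# ⟩
      0#                            ∎
    root-of-derivative : ∀ {s} → s ∈ₛ rs → eval′ (prodLinear rs) s ≈ 0# →
                         eval′ (prodLinear (r ∷ rs)) s ≈ 0#
    root-of-derivative {s} s∈rs slope≈0 = begin
      eval′ (prodLinear (r ∷ rs)) s ≈⟨ slope s ⟩
      eval (prodLinear rs) s + (s - r) * eval′ (prodLinear rs) s
        ≈⟨ +-cong (prodLinear-root s∈rs) (trans (*-congˡ slope≈0) (zeroʳ _)) ⟩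
      0# + 0#                       ≈⟨ +-identityʳ 0# ⟩
      0#                            ∎

  AlgClosed⇒square-root : AlgClosed → ∀ a → ∃ λ y → y * y ≈ a
  AlgClosed⇒square-root closed a with closed (- a) (0# ∷ [])
  ... | y , root = y , (begin
    y * y
      ≈⟨ solve 2 (λ y a → y :* y := (:- a :+ y :* (κ 0 :+ y :* (κ 1 :+ y :* κ 0))) :+ a) refl y a ⟩
    (- a + y * (0# + y * (1# + y * 0#))) + a  ≈⟨ +-congʳ root ⟩
    0# + a                                    ≈⟨ +-identityˡ a ⟩
    a                                         ∎)

module FieldProperties {c ℓ} (R : CommutativeRing c ℓ) (isField : Over.IsField R) where
  open CommutativeRing R
  open Over R
  open IntegerCoefficients R
  open Polynomials R
  open import Relation.Binary.Reasoning.Setoid setoid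
  open import Algebra.Properties.Group +-group using (x∙y⁻¹≈ε⇒x≈y)
  open Membership setoid using () renaming (_∈_ to _∈ₛ_)
  open Permutation setoid using (_↭_; ↭-prep; ↭-sym; ↭-trans; ↭-reflexive-≋)
  open PermutationProperties setoid using (∈-resp-↭; Unique-resp-↭)
  open SetoidLists setoid
  open Subset setoid using (_⊆_)

  nonzero-cancel : ∀ {a b} → ¬ a ≈ 0# → a * b ≈ 0# → b ≈ 0#
  nonzero-cancel {a} {b} a≉0 ab≈0 with proj₂ isField a a≉0
  ... | a⁻¹ , aa⁻¹≈1 = begin
    b              ≈⟨ *-identityˡ b ⟨
    1# * b         ≈⟨ *-congʳ aa⁻¹≈1 ⟨
    a * a⁻¹ * b    ≈⟨ solve 3 (λ a a⁻¹ b → a :* a⁻¹ :* b := a⁻¹ :* (a :* b)) refl a a⁻¹ b ⟩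
    a⁻¹ * (a * b)  ≈⟨ *-congˡ ab≈0 ⟩
    a⁻¹ * 0#       ≈⟨ zeroʳ a⁻¹ ⟩
    0#             ∎

  nonzero-* : ∀ {a b} → ¬ a ≈ 0# → ¬ b ≈ 0# → ¬ a * b ≈ 0#
  nonzero-* a≉0 b≉0 ab≈0 = b≉0 (nonzero-cancel a≉0 ab≈0)

  divide : ∀ a {b} → ¬ b ≈ 0# → ∃ λ q → q * b ≈ a
  divide a {b} b≉0 with proj₂ isField b b≉0
  ... | b⁻¹ , bb⁻¹≈1 = a * b⁻¹ , (begin
    a * b⁻¹ * b    ≈⟨ solve 3 (λ a b b⁻¹ → a :* b⁻¹ :* b := a :* (b :* b⁻¹)) refl a b b⁻¹ ⟩
    a * (b * b⁻¹)  ≈⟨ *-congˡ bb⁻¹≈1 ⟩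
    a * 1#         ≈⟨ *-identityʳ a ⟩
    a              ∎)

  -- No decidable equality is needed: an element t of xs other than r is a root of ∏ rs,
  -- because t - r is invertible.
  roots-⊆⇒↭ : ∀ xs rs → Unique setoid xs → Unique setoid rs → rs ⊆ xs →
              (∀ {t} → t ∈ₛ xs → eval (prodLinear rs) t ≈ 0#) → xs ↭ rs
  roots-⊆⇒↭ [] [] _ _ _ _ = ↭-reflexive-≋ []
  roots-⊆⇒↭ (t ∷ xs) [] _ _ _ roots = ⊥-elim (proj₁ isField (begin
    1#            ≈⟨ solve 1 (λ t → κ 1 := κ 1 :+ t :* κ 0) refl t ⟩
    1# + t * 0#   ≈⟨ roots (here refl) ⟩
    0#            ∎))
  roots-⊆⇒↭ xs (r ∷ rs) xs! (r∉rs ∷ rs!) r∷rs⊆xs roots = ↭-trans xs↭r∷xs′ (↭-prep r xs′↭rs)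
    where
    split : ∃ λ xs′ → xs ↭ r ∷ xs′
    split = ∈⇒↭∷ (r∷rs⊆xs (here refl))
    xs′ : List Carrier
    xs′ = proj₁ split
    xs↭r∷xs′ : xs ↭ r ∷ xs′
    xs↭r∷xs′ = proj₂ split
    r∷xs′! : Unique setoid (r ∷ xs′)
    r∷xs′! = Unique-resp-↭ xs↭r∷xs′ xs!
    rs⊆xs′ : rs ⊆ xs′
    rs⊆xs′ s∈rs with ∈-resp-↭ xs↭r∷xs′ (r∷rs⊆xs (there s∈rs))
    ... | here s≈r = ⊥-elim (head-distinct (r∉rs ∷ rs!) s∈rs s≈r)
    ... | there s∈xs′ = s∈xs′
    roots′ : ∀ {t} → t ∈ₛ xs′ → eval (prodLinear rs) t ≈ 0#
    roots′ {t} t∈xs′ =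
      nonzero-cancel (λ t-r≈0 → head-distinct r∷xs′! t∈xs′ (x∙y⁻¹≈ε⇒x≈y t r t-r≈0))
        (trans (sym (eval-linear-*p r (prodLinear rs) t))
               (roots (∈-resp-↭ (↭-sym xs↭r∷xs′) (there t∈xs′))))
    xs′↭rs : xs′ ↭ rs
    xs′↭rs = roots-⊆⇒↭ xs′ rs (AllPairs.tail r∷xs′!) rs! rs⊆xs′ roots′

module ThreeDivisionPolynomial {c ℓ} (R : CommutativeRing c ℓ) (isField : Over.IsField R)
  (A B C : CommutativeRing.Carrier R) (3≉0 : ¬ CommutativeRing._≈_ R (Over.three R) (CommutativeRing.0# R)) where
  open CommutativeRing R
  open Over R
  open Curve A B C
  open IntegerCoefficients R
  open Polynomials R
  open FieldProperties R isField
  open import Relation.Binary.Reasoning.Setoid setoid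
  open import Algebra.Properties.Group +-group using (x∙y⁻¹≈ε⇒x≈y)
  open Membership setoid using () renaming (_∈_ to _∈ₛ_)
  open Permutation setoid using (_↭_)

  cubic cubic′ : Carrier → Carrier
  cubic X = X * X * X + A * X * X + B * X + C
  cubic′ X = three * X * X + two * A * X + B

  3⁻¹ : Carrier
  3⁻¹ = proj₁ (proj₂ isField three 3≉0)

  3*3⁻¹≈1 : three * 3⁻¹ ≈ 1#
  3*3⁻¹≈1 = proj₂ (proj₂ isField three 3≉0)

  -- The 3-division polynomial 3X⁴ + 4AX³ + 6BX² + 12CX + (4AC - B²), made monic.
  ψ-coefficients : List Carrier
  ψ-coefficients =
    (fromℕ 4 * A * C - B * B) * 3⁻¹ ∷ fromℕ 12 * C * 3⁻¹ ∷ fromℕ 6 * B * 3⁻¹ ∷ fromℕ 4 * A * 3⁻¹ ∷ []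

  ψ : Poly
  ψ = monic ψ-coefficients

  three*ψ : ∀ X → three * eval ψ X ≈ fromℕ 4 * cubic X * (three * X + A) - cubic′ X * cubic′ X
  three*ψ X = begin
    three * eval ψ X
      ≈⟨ solve 5 (λ X A B C i →
           κ 3 :* ((κ 4 :* A :* C :- B :* B) :* i :+ X :* (κ 12 :* C :* i :+ X :* (κ 6 :* B :* i
             :+ X :* (κ 4 :* A :* i :+ X :* (κ 1 :+ X :* κ 0)))))
           := κ 3 :* (X :* X :* X :* X) :+ κ 3 :* i :* (κ 4 :* A :* X :* X :* X :+ κ 6 :* B :* X :* X
             :+ κ 12 :* C :* X :+ (κ 4 :* A :* C :- B :* B)))
         refl X A B C 3⁻¹ ⟩
    three * (X * X * X * X) + three * 3⁻¹ * lower
      ≈⟨ +-congˡ (trans (*-congʳ 3*3⁻¹≈1) (*-identityˡ lower)) ⟩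
    three * (X * X * X * X) + lower
      ≈⟨ solve 4 (λ X A B C →
           κ 3 :* (X :* X :* X :* X) :+ (κ 4 :* A :* X :* X :* X :+ κ 6 :* B :* X :* X
             :+ κ 12 :* C :* X :+ (κ 4 :* A :* C :- B :* B))
           := κ 4 :* (X :* X :* X :+ A :* X :* X :+ B :* X :+ C) :* (κ 3 :* X :+ A)
             :- (κ 3 :* X :* X :+ κ 2 :* A :* X :+ B) :* (κ 3 :* X :* X :+ κ 2 :* A :* X :+ B))
         refl X A B C ⟩
    fromℕ 4 * cubic X * (three * X + A) - cubic′ X * cubic′ X ∎
    where
    lower : Carrier
    lower = fromℕ 4 * A * X * X * X + fromℕ 6 * B * X * X + fromℕ 12 * C * X + (fromℕ 4 * A * C - B * B)

  eval′-ψ : ∀ X → eval′ ψ X ≈ fromℕ 4 * cubic X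
  eval′-ψ X = begin
    eval′ ψ X
      ≈⟨ solve 5 (λ X A B C i →
           κ 1 :* (κ 12 :* C :* i) :+ X :* (κ 2 :* (κ 6 :* B :* i) :+ X :* (κ 3 :* (κ 4 :* A :* i)
             :+ X :* (κ 4 :* κ 1 :+ X :* κ 0)))
           := κ 4 :* X :* X :* X :+ κ 3 :* i :* (κ 4 :* A :* X :* X :+ κ 4 :* B :* X :+ κ 4 :* C))
         refl X A B C 3⁻¹ ⟩
    fromℕ 4 * X * X * X + three * 3⁻¹ * lower
      ≈⟨ +-congˡ (trans (*-congʳ 3*3⁻¹≈1) (*-identityˡ lower)) ⟩
    fromℕ 4 * X * X * X + lower
      ≈⟨ solve 4 (λ X A B C → κ 4 :* X :* X :* X :+ (κ 4 :* A :* X :* X :+ κ 4 :* B :* X :+ κ 4 :* C)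
                            := κ 4 :* (X :* X :* X :+ A :* X :* X :+ B :* X :+ C))
                 refl X A B C ⟩
    fromℕ 4 * cubic X ∎
    where
    lower : Carrier
    lower = fromℕ 4 * A * X * X + fromℕ 4 * B * X + fromℕ 4 * C

  three*ψ-on-tangent : ∀ {x y λ′} → y * y ≈ cubic x → λ′ * (two * y) ≈ cubic′ x →
                       three * eval ψ x ≈ fromℕ 4 * (y * y) * (three * x + A - λ′ * λ′)
  three*ψ-on-tangent {x} {y} {λ′} y²≈h slope = begin
    three * eval ψ x
      ≈⟨ three*ψ x ⟩
    fromℕ 4 * cubic x * (three * x + A) - cubic′ x * cubic′ x
      ≈⟨ +-cong (*-congʳ (*-congˡ (sym y²≈h))) (-‿cong (sym (*-cong slope slope))) ⟩
    fromℕ 4 * (y * y) * (three * x + A) - λ′ * (two * y) * (λ′ * (two * y))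
      ≈⟨ solve 4 (λ x y l A → κ 4 :* (y :* y) :* (κ 3 :* x :+ A) :- l :* (κ 2 :* y) :* (l :* (κ 2 :* y))
                            := κ 4 :* (y :* y) :* (κ 3 :* x :+ A :- l :* l))
                 refl x y λ′ A ⟩
    fromℕ 4 * (y * y) * (three * x + A - λ′ * λ′) ∎

  x-doubling : ∀ {x y x₂ y₂} → OnCurve (aff x y) → Add (aff x y) (aff x y) (aff x₂ y₂) →
               x₂ * eval′ ψ x ≈ x * eval′ ψ x - three * eval ψ x
  x-doubling _ (chord _ x≉x _ _ _) = ⊥-elim (x≉x refl)
  x-doubling {x} {y} {x₂} y²≈h (tangent λ′ _ _ _ slope x₂≈ _) = begin
    x₂ * eval′ ψ x
      ≈⟨ *-cong x₂≈ (trans (eval′-ψ x) (*-congˡ (sym y²≈h))) ⟩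
    (λ′ * λ′ - A - two * x) * (fromℕ 4 * (y * y))
      ≈⟨ solve 4 (λ x y l A → (l :* l :- A :- κ 2 :* x) :* (κ 4 :* (y :* y))
                            := x :* (κ 4 :* (y :* y)) :- κ 4 :* (y :* y) :* (κ 3 :* x :+ A :- l :* l))
                 refl x y λ′ A ⟩
    x * (fromℕ 4 * (y * y)) - fromℕ 4 * (y * y) * (three * x + A - λ′ * λ′)
      ≈⟨ +-cong (*-congˡ (trans (*-congˡ y²≈h) (sym (eval′-ψ x))))
                (-‿cong (sym (three*ψ-on-tangent y²≈h slope))) ⟩
    x * eval′ ψ x - three * eval ψ x ∎

  ThreeTorsionX : Carrier → Set (c ⊔ ℓ)
  ThreeTorsionX t = ∃ λ y → OnCurve (aff t y) × ThreeTorsion (aff t y)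

  threeTorsion⇒ψ-root : ∀ {t} → ThreeTorsionX t → eval ψ t ≈ 0#
  threeTorsion⇒ψ-root (_ , _ , _ , chord _ t≉t _ _ _ , _) = ⊥-elim (t≉t refl)
  threeTorsion⇒ψ-root (_ , _ , _ , vertical _ _ , O-left ())
  threeTorsion⇒ψ-root {t} (y , y²≈h , _ , tangent λ′ _ _ _ slope x₃≈ _ , vertical x₃≈t _) =
    nonzero-cancel 3≉0 (begin
      three * eval ψ t                                ≈⟨ three*ψ-on-tangent y²≈h slope ⟩
      fromℕ 4 * (y * y) * (three * t + A - λ′ * λ′)   ≈⟨ *-congˡ tangent-is-vertical ⟩
      fromℕ 4 * (y * y) * 0#                          ≈⟨ zeroʳ _ ⟩
      0#                                              ∎)
    where
    tangent-is-vertical : three * t + A - λ′ * λ′ ≈ 0#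
    tangent-is-vertical = begin
      three * t + A - λ′ * λ′
        ≈⟨ solve 3 (λ t A l → κ 3 :* t :+ A :- l :* l := t :- (l :* l :- A :- κ 2 :* t)) refl t A λ′ ⟩
      t - (λ′ * λ′ - A - two * t)   ≈⟨ +-congˡ (-‿cong (trans (sym x₃≈) x₃≈t)) ⟩
      t - t                         ≈⟨ -‿inverseʳ t ⟩
      0#                            ∎

  -- Δ is the resultant of the cubic and its derivative; these are the Bézout cofactors.
  cubic-cofactor cubic′-cofactor : Carrier → Carrier
  cubic-cofactor t =
    (fromℕ 18 * B - fromℕ 6 * A * A) * t + (fromℕ 15 * A * B - fromℕ 4 * A * A * A - fromℕ 27 * C)
  cubic′-cofactor t =
    (fromℕ 2 * A * A - fromℕ 6 * B) * t * t + (fromℕ 2 * A * A * A - fromℕ 7 * A * B + fromℕ 9 * C) * t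
      + (A * A * B - fromℕ 4 * B * B + fromℕ 3 * A * C)

  discriminant-Bézout : ∀ t →
    discriminant A B C ≈ cubic-cofactor t * cubic t + cubic′-cofactor t * cubic′ t
  discriminant-Bézout t = solve 4 (λ A B C t →
      A :* A :* B :* B :- κ 2 :* κ 2 :* B :* B :* B :- κ 2 :* κ 2 :* A :* A :* A :* C
        :- κ 3 :* κ 3 :* κ 3 :* C :* C :+ κ 2 :* κ 3 :* κ 3 :* A :* B :* C
      := ((κ 18 :* B :- κ 6 :* A :* A) :* t :+ (κ 15 :* A :* B :- κ 4 :* A :* A :* A :- κ 27 :* C))
           :* (t :* t :* t :+ A :* t :* t :+ B :* t :+ C)
         :+ ((κ 2 :* A :* A :- κ 6 :* B) :* t :* t :+ (κ 2 :* A :* A :* A :- κ 7 :* A :* B :+ κ 9 :* C) :* t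
           :+ (A :* A :* B :- κ 4 :* B :* B :+ κ 3 :* A :* C))
           :* (κ 3 :* t :* t :+ κ 2 :* A :* t :+ B))
    refl A B C t

  ψ-root⇒cubic≉0 : ¬ discriminant A B C ≈ 0# → ∀ {t} → eval ψ t ≈ 0# → ¬ cubic t ≈ 0#
  ψ-root⇒cubic≉0 Δ≉0 {t} ψ≈0 h≈0 = nonzero-* Δ≉0 Δ≉0 (begin
    Δ * Δ             ≈⟨ *-cong Δ≈V*h′ Δ≈V*h′ ⟩
    V * h′ * (V * h′) ≈⟨ solve 2 (λ v d → v :* d :* (v :* d) := v :* v :* (d :* d)) refl V h′ ⟩
    V * V * (h′ * h′) ≈⟨ *-congˡ h′²≈0 ⟩
    V * V * 0#        ≈⟨ zeroʳ _ ⟩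
    0#                ∎)
    where
    Δ h′ V : Carrier
    Δ = discriminant A B C
    h′ = cubic′ t
    V = cubic′-cofactor t
    Δ≈V*h′ : Δ ≈ V * h′
    Δ≈V*h′ = begin
      Δ                                   ≈⟨ discriminant-Bézout t ⟩
      cubic-cofactor t * cubic t + V * h′ ≈⟨ +-congʳ (trans (*-congˡ h≈0) (zeroʳ _)) ⟩
      0# + V * h′                         ≈⟨ +-identityˡ _ ⟩
      V * h′                              ∎
    h′²≈0 : h′ * h′ ≈ 0#
    h′²≈0 = begin
      h′ * h′
        ≈⟨ solve 2 (λ a d → d :* d := a :- (a :- d :* d)) refl (fromℕ 4 * cubic t * (three * t + A)) h′ ⟩
      fromℕ 4 * cubic t * (three * t + A) - (fromℕ 4 * cubic t * (three * t + A) - h′ * h′)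
        ≈⟨ +-cong (*-congʳ (*-congˡ h≈0)) (-‿cong (sym (three*ψ t))) ⟩
      fromℕ 4 * 0# * (three * t + A) - three * eval ψ t
        ≈⟨ +-congˡ (-‿cong (*-congˡ ψ≈0)) ⟩
      fromℕ 4 * 0# * (three * t + A) - three * 0#
        ≈⟨ solve 2 (λ a b → κ 4 :* κ 0 :* a :- b :* κ 0 := κ 0) refl (three * t + A) three ⟩
      0# ∎

  module _ (closed : AlgClosed) (2≉0 : ¬ two ≈ 0#) where

    4≉0 : ¬ fromℕ 4 ≈ 0#
    4≉0 4≈0 = nonzero-* 2≉0 2≉0 (trans (solve 0 (κ 2 :* κ 2 := κ 4) refl) 4≈0)

    ψ-root⇒threeTorsion : ∀ {t} → eval ψ t ≈ 0# → ¬ cubic t ≈ 0# → ThreeTorsionX t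
    ψ-root⇒threeTorsion {t} ψ≈0 h≉0 =
      y , y²≈h , aff x₃ y₃ , tangent λ′ refl refl y≉0 slope refl refl , vertical x₃≈t y₃+y≈0
      where
      root : ∃ λ y → y * y ≈ cubic t
      root = AlgClosed⇒square-root closed (cubic t)
      y : Carrier
      y = proj₁ root
      y²≈h : y * y ≈ cubic t
      y²≈h = proj₂ root
      y≉0 : ¬ y ≈ 0#
      y≉0 y≈0 = h≉0 (trans (sym y²≈h) (trans (*-congʳ y≈0) (zeroˡ y)))
      tangentSlope : ∃ λ λ′ → λ′ * (two * y) ≈ cubic′ t
      tangentSlope = divide (cubic′ t) (nonzero-* 2≉0 y≉0)
      λ′ : Carrier
      λ′ = proj₁ tangentSlope
      slope : λ′ * (two * y) ≈ cubic′ t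
      slope = proj₂ tangentSlope
      x₃ y₃ : Carrier
      x₃ = λ′ * λ′ - A - two * t
      y₃ = λ′ * (t - x₃) - y
      tangent-is-vertical : three * t + A - λ′ * λ′ ≈ 0#
      tangent-is-vertical = nonzero-cancel (nonzero-* 4≉0 λ y²≈0 → h≉0 (trans (sym y²≈h) y²≈0)) (begin
        fromℕ 4 * (y * y) * (three * t + A - λ′ * λ′) ≈⟨ three*ψ-on-tangent y²≈h slope ⟨
        three * eval ψ t                              ≈⟨ *-congˡ ψ≈0 ⟩
        three * 0#                                    ≈⟨ zeroʳ three ⟩
        0#                                            ∎)
      x₃≈t : x₃ ≈ t
      x₃≈t = x∙y⁻¹≈ε⇒x≈y x₃ t (begin
        x₃ - t
          ≈⟨ solve 3 (λ t A l → l :* l :- A :- κ 2 :* t :- t := :- (κ 3 :* t :+ A :- l :* l)) refl t A λ′ ⟩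
        - (three * t + A - λ′ * λ′)   ≈⟨ -‿cong tangent-is-vertical ⟩
        - 0#                          ≈⟨ solve 0 (:- κ 0 := κ 0) refl ⟩
        0#                            ∎)
      y₃+y≈0 : y₃ + y ≈ 0#
      y₃+y≈0 = begin
        λ′ * (t - x₃) - y + y  ≈⟨ solve 3 (λ l d y → l :* d :- y :+ y := l :* d) refl λ′ (t - x₃) y ⟩
        λ′ * (t - x₃)          ≈⟨ *-congˡ (+-congˡ (-‿cong x₃≈t)) ⟩
        λ′ * (t - t)           ≈⟨ *-congˡ (-‿inverseʳ t) ⟩
        λ′ * 0#                ≈⟨ zeroʳ λ′ ⟩
        0#                     ∎

    module _ (Δ≉0 : ¬ discriminant A B C ≈ 0#) (xs : List Carrier) (xs! : Unique setoid xs)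
             (xs-spec : ∀ t → (t ∈ₛ xs → ThreeTorsionX t) × (ThreeTorsionX t → t ∈ₛ xs)) where

      x-coordinates≃ψ : prodLinear xs ≃ ψ
      x-coordinates≃ψ = ≃-trans (prodLinear-resp-↭ xs↭rs) (≃-sym ψ≃rs)
        where
        split : ∃ λ rs → ψ ≃ prodLinear rs
        split = monic-splits closed ψ-coefficients
        rs : List Carrier
        rs = proj₁ split
        ψ≃rs : ψ ≃ prodLinear rs
        ψ≃rs = proj₂ split
        ψ-root : ∀ {s} → s ∈ₛ rs → eval ψ s ≈ 0#
        ψ-root s∈rs = trans (eval-≈ ψ≃rs _) (prodLinear-root s∈rs)
        rs! : Unique setoid rs
        rs! = simple-roots⇒Unique rs λ {s} s∈rs slope≈0 →
          ψ-root⇒cubic≉0 Δ≉0 (ψ-root s∈rs)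
            (nonzero-cancel 4≉0 (trans (sym (eval′-ψ s)) (trans (eval′-≈ ψ≃rs s) slope≈0)))
        rs⊆xs : ∀ {s} → s ∈ₛ rs → s ∈ₛ xs
        rs⊆xs {s} s∈rs =
          proj₂ (xs-spec s) (ψ-root⇒threeTorsion (ψ-root s∈rs) (ψ-root⇒cubic≉0 Δ≉0 (ψ-root s∈rs)))
        xs-roots : ∀ {t} → t ∈ₛ xs → eval (prodLinear rs) t ≈ 0#
        xs-roots {t} t∈xs = trans (sym (eval-≈ ψ≃rs t)) (threeTorsion⇒ψ-root (proj₁ (xs-spec t) t∈xs))
        xs↭rs : xs ↭ rs
        xs↭rs = roots-⊆⇒↭ xs rs xs! rs! rs⊆xs xs-roots

      lattès-doubling : ∀ {x y x₂ y₂} → OnCurve (aff x y) → Add (aff x y) (aff x y) (aff x₂ y₂) →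
                        let f = prodLinear xs in x₂ * eval′ f x ≈ x * eval′ f x - three * eval f x
      lattès-doubling {x} {x₂ = x₂} onE 2P≈ = begin
        x₂ * eval′ (prodLinear xs) x
          ≈⟨ *-congˡ (eval′-≈ x-coordinates≃ψ x) ⟩
        x₂ * eval′ ψ x
          ≈⟨ x-doubling onE 2P≈ ⟩
        x * eval′ ψ x - three * eval ψ x
          ≈⟨ +-cong (*-congˡ (eval′-≈ x-coordinates≃ψ x)) (-‿cong (*-congˡ (eval-≈ x-coordinates≃ψ x))) ⟨
        x * eval′ (prodLinear xs) x - three * eval (prodLinear xs) x ∎

module RingHomomorphismTransport {c₁ ℓ₁ c₂ ℓ₂} (K : CommutativeRing c₁ ℓ₁) (L : CommutativeRing c₂ ℓ₂)
  (ι : CommutativeRing.Carrier K → CommutativeRing.Carrier L)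
  (hom : RingMorphisms.IsRingHomomorphism (CommutativeRing.rawRing K) (CommutativeRing.rawRing L) ι) where
  module K = CommutativeRing K
  module KO = Over K
  open CommutativeRing L
  open Over L
  open RingMorphisms.IsRingHomomorphism hom
  open import Relation.Binary.Reasoning.Setoid setoid

  infixl 6 _⟨+⟩_ _⟨-⟩_
  infixl 7 _⟨*⟩_

  _⟨+⟩_ : ∀ {x y u v} → ι x ≈ u → ι y ≈ v → ι (x K.+ y) ≈ u + v
  _⟨+⟩_ {x} {y} p q = trans (+-homo x y) (+-cong p q)

  _⟨*⟩_ : ∀ {x y u v} → ι x ≈ u → ι y ≈ v → ι (x K.* y) ≈ u * v
  _⟨*⟩_ {x} {y} p q = trans (*-homo x y) (*-cong p q)

  _⟨-⟩_ : ∀ {x y u v} → ι x ≈ u → ι y ≈ v → ι (x K.- y) ≈ u - v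
  _⟨-⟩_ {x} {y} p q = trans (+-homo x (K.- y)) (+-cong p (trans (-‿homo y) (-‿cong q)))

  ι-two : ι KO.two ≈ two
  ι-two = 1#-homo ⟨+⟩ 1#-homo

  ι-three : ι KO.three ≈ three
  ι-three = 1#-homo ⟨+⟩ 1#-homo ⟨+⟩ 1#-homo

  ι-discriminant : ∀ a b c → ι (KO.discriminant a b c) ≈ discriminant (ι a) (ι b) (ι c)
  ι-discriminant a b c =
    ιa ⟨*⟩ ιa ⟨*⟩ ιb ⟨*⟩ ιb
      ⟨-⟩ ι-two ⟨*⟩ ι-two ⟨*⟩ ιb ⟨*⟩ ιb ⟨*⟩ ιb
      ⟨-⟩ ι-two ⟨*⟩ ι-two ⟨*⟩ ιa ⟨*⟩ ιa ⟨*⟩ ιa ⟨*⟩ ιc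
      ⟨-⟩ ι-three ⟨*⟩ ι-three ⟨*⟩ ι-three ⟨*⟩ ιc ⟨*⟩ ιc
      ⟨+⟩ ι-two ⟨*⟩ ι-three ⟨*⟩ ι-three ⟨*⟩ ιa ⟨*⟩ ιb ⟨*⟩ ιc
    where
    ιa : ι a ≈ ι a
    ιa = refl
    ιb : ι b ≈ ι b
    ιb = refl
    ιc : ι c ≈ ι c
    ιc = refl

  ≉0-transport : KO.IsField → ¬ 1# ≈ 0# → ∀ {z u} → ι z ≈ u → ¬ z K.≈ K.0# → ¬ u ≈ 0#
  ≉0-transport K-field 1≉0 {z} ιz≈u z≉0 u≈0 with proj₂ K-field z z≉0
  ... | w , zw≈1 = 1≉0 (begin
    1#            ≈⟨ 1#-homo ⟨
    ι K.1#        ≈⟨ ⟦⟧-cong zw≈1 ⟨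
    ι (z K.* w)   ≈⟨ *-homo z w ⟩
    ι z * ι w     ≈⟨ *-congʳ (trans ιz≈u u≈0) ⟩
    0# * ι w      ≈⟨ zeroˡ (ι w) ⟩
    0#            ∎)

mainTheorem9 : ∀ {c₁ ℓ₁ c₂ ℓ₂} (K : CommutativeRing c₁ ℓ₁) (L : CommutativeRing c₂ ℓ₂) →
  -- K is a field of characteristic ≠ 2, 3
  Over.IsField K → Over.CharNot2or3 K →
  -- L is an algebraic closure-like extension: an algebraically closed field with K ↪ L
  Over.IsField L → Over.AlgClosed L →
  (ι : CommutativeRing.Carrier K → CommutativeRing.Carrier L) →
  RingMorphisms.IsRingHomomorphism (CommutativeRing.rawRing K) (CommutativeRing.rawRing L) ι →
  -- E : y² = x³ + a x² + b x + c over K, nonsingular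
  (a b c : CommutativeRing.Carrier K) →
  ¬ (CommutativeRing._≈_ K (Over.discriminant K a b c) (CommutativeRing.0# K)) →
  -- xs : the distinct x-coordinates of the nonzero 3-torsion points of E(L)
  (xs : List (CommutativeRing.Carrier L)) →
  Unique (CommutativeRing.setoid L) xs →
  (∀ t → (_∈_ (CommutativeRing.setoid L) t xs →
            ∃ λ y → Over.Curve.OnCurve L (ι a) (ι b) (ι c) (Over.aff t y)
              × Over.Curve.ThreeTorsion L (ι a) (ι b) (ι c) (Over.aff t y))
       × ((∃ λ y → Over.Curve.OnCurve L (ι a) (ι b) (ι c) (Over.aff t y)
              × Over.Curve.ThreeTorsion L (ι a) (ι b) (ι c) (Over.aff t y)) →
            _∈_ (CommutativeRing.setoid L) t xs)) →
  -- for every P = (x , y) ∈ E(L) with [2]P = (x₂ , y₂) ≠ O :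
  -- x([2]P) = x - 3 f(x) / f'(x), in cleared-denominator form
  ∀ x y x₂ y₂ →
  Over.Curve.OnCurve L (ι a) (ι b) (ι c) (Over.aff x y) →
  Over.Curve.Add L (ι a) (ι b) (ι c) (Over.aff x y) (Over.aff x y) (Over.aff x₂ y₂) →
  let open CommutativeRing L
      f = Over.prodLinear L xs
      f' = Over.deriv L f
  in x₂ * Over.eval L f' x ≈ x * Over.eval L f' x - Over.three L * Over.eval L f x
mainTheorem9 K L K-field (2≉0 , 3≉0) L-field closed ι hom a b c Δ≉0 xs xs! xs-spec _ _ _ _ =
  ThreeDivisionPolynomial.lattès-doubling L L-field (ι a) (ι b) (ι c) (nonzero ι-three 3≉0) closed
    (nonzero ι-two 2≉0) (nonzero (ι-discriminant a b c) Δ≉0) xs xs! xs-spec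
  where
  open RingHomomorphismTransport K L ι hom using (ι-two; ι-three; ι-discriminant; ≉0-transport)
  module K = CommutativeRing K
  module L = CommutativeRing L
  nonzero : ∀ {z u} → ι z L.≈ u → ¬ z K.≈ K.0# → ¬ u L.≈ L.0#
  nonzero = ≉0-transport K-field (proj₁ L-field)
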